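{- Let $n\ge8$ be divisible by $4$. Then there exists a latin square of order $n$ which contains a triplex but no transversal.
   Context: A $k$-plex of a latin square of order $n$ is a set of $kn$ cells with exactly $k$ cells in each row and each column and each symbol occurring exactly $k$ times; a transversal is a $1$-plex and a triplex is a $3$-plex. -}

module Defs where

open import Data.Nat using (ℕ; zero; suc; _+_; _*_)
open import Data.Fin using (Fin)
open import Data.Bool using (Bool; true; false; if_then_else_; _∧_)
open import Data.Product using (_×_; ∃; ∃-syntax)
open import Relation.Binary.PropositionalEquality using (_≡_)
open import Data.Fin.Properties using (_≟_)
open import Relation.Nullary.Decidable using (⌊_⌋)

count : ∀ {m} → (Fin m → Bool) → ℕ
count {zero}  f = 0
count {suc m} f = (if f Data.Fin.zero then 1 else 0) + count {m} (λ i → f (Data.Fin.suc i))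

sumFin : ∀ {m} → (Fin m → ℕ) → ℕ
sumFin {zero}  g = 0
sumFin {suc m} g = g Data.Fin.zero + sumFin {m} (λ i → g (Data.Fin.suc i))

LatinSquare : ℕ → Set
LatinSquare n = Fin n → Fin n → Fin n

IsLatin : ∀ {n} → LatinSquare n → Set
IsLatin {n} L =
  (∀ (r s : Fin n) → ∃[ c ] (L r c ≡ s × (∀ c' → L r c' ≡ s → c' ≡ c))) ×
  (∀ (c s : Fin n) → ∃[ r ] (L r c ≡ s × (∀ r' → L r' c ≡ s → r' ≡ r)))

CellSet : ℕ → Set
CellSet n = Fin n → Fin n → Bool

IsPlex : ∀ {n} → ℕ → LatinSquare n → CellSet n → Set
IsPlex {n} k L P =
  (∀ r → count (λ c → P r c) ≡ k) ×
  (∀ c → count (λ r → P r c) ≡ k) ×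
  (∀ s → sumFin (λ r → count (λ c → P r c ∧ ⌊ L r c ≟ s ⌋)) ≡ k)

HasTransversal : ∀ {n} → LatinSquare n → Set
HasTransversal {n} L = ∃[ P ] IsPlex 1 L P

HasTriplex : ∀ {n} → LatinSquare n → Set
HasTriplex {n} L = ∃[ P ] IsPlex 3 L P

module Submission where

-- Write n = 4m with m ≥ 2 and let L be the addition table of ℤₙ with rows 0 and m exchanged
-- inside the four columns 0, m, 2m, 3m.
-- No transversal: over a transversal, Σ L r c, Σ r and Σ c all equal n(n-1)/2, while cellwise
-- L r c differs from r + c by a multiple of n plus the effect of the exchange, which is
-- m(b - a) where a, b ∈ {0, 1} record whether the transversal's cells in rows m and 0 were
-- exchanged.  With n = 4m this leaves 4Q + a + 2 = 8m + b, impossible modulo 4.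
-- Triplex: row y gets the three cells (y, y + offset k y) for three explicit offset functions.
-- Every column and every symbol is then hit by three explicitly named cells in distinct rows,
-- and as there are only 3n cells, each is hit exactly three times.


open import Defs
open import Data.Bool using (Bool; true; false; if_then_else_; _∧_; _∨_)
open import Data.Bool.Properties using (∨-zeroʳ)
open import Data.Empty using (⊥; ⊥-elim)
open import Data.Fin using (Fin; zero; suc; toℕ; fromℕ<; punchOut)
open import Data.Fin.Permutation.Components using (transpose; transpose-inverse)
open import Data.Fin.Properties
  using (toℕ-injective; toℕ-fromℕ<; toℕ<n; ¬Fin0; 0≢1+n; punchIn-punchOut; punchOut-injective; any?; injective⇒≤)
  renaming (_≟_ to _≟ᶠ_; suc-injective to suc-injectiveᶠ)
open import Data.Nat using (ℕ; zero; suc; _+_; _*_; _∸_; _≤_; _<_; z≤n; s≤s; s≤s⁻¹; s<s⁻¹; NonZero)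
open import Data.Nat.DivMod
  using (_%_; _/_; _mod_; %-distribˡ-+; m%n%n≡m%n; m≡m%n+[m/n]*n; m%n≤n; m%n<n; [m+kn]%n≡m%n; [m+n]%n≡m%n;
         m<n⇒m%n≡m; n%n≡0; m∣n⇒o%n%m≡o%m; %-remove-+ˡ)
open import Data.Nat.Divisibility using (_∣_; divides; m∣m*n; ∣-refl; _∣0)
open import Data.Nat.Properties
  using (+-0-commutativeMonoid; +-*-semiring; _≟_; _<?_; <-cmp; module ≤-Reasoning;
         +-comm; +-assoc; +-suc; +-identityʳ; *-comm; *-identityˡ; *-identityʳ; *-zeroʳ; *-suc;
         +-cancelˡ-≡; *-cancelˡ-≡; *-cancelˡ-<; m+n≡0⇒m≡0; m+n≡0⇒n≡0; m+[n∸m]≡n; m∸n≡0⇒m≤n; m≤n⇒∃[o]m+o≡n;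
         ≤-refl; ≤-reflexive; ≤-trans; ≤-antisym; ≤-pred; <-trans; <-irrefl; <-≤-trans; <⇒≢; <⇒≱; ≤⇒≯;
         n<1+n; n≤1+n; m≤n⇒m≤1+n; m≤m+n; m≤n+m; m<m+n; m<n+m;
         +-mono-≤; +-monoˡ-≤; +-monoʳ-≤; +-monoˡ-<; *-monoʳ-≤)
open import Algebra.Properties.CommutativeMonoid.Sum +-0-commutativeMonoid
  using (sum; sum-cong-≗; ∑-distrib-+; ∑-comm; sum-replicate-zero; sum-remove)
open import Algebra.Properties.Semiring.Sum +-*-semiring using (*-distribˡ-sum; *-distribʳ-sum)
open import Data.Nat.Tactic.RingSolver using (solve-∀)
open import Data.Product using (Σ; ∃-syntax; _×_; _,_; proj₁; proj₂)
open import Data.Sum using (_⊎_; inj₁; inj₂)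
open import Data.Vec.Functional using (removeAt; _∷_; [])
open import Function using (id; _∘_)
open import Function.Definitions using (Injective)
open import Relation.Binary using (tri<; tri≈; tri>)
open import Relation.Binary.PropositionalEquality
open import Relation.Nullary using (¬_; Dec; does; yes; no; contradiction)
open import Relation.Nullary.Decidable using (⌊_⌋; dec-true; dec-false; isYes≗does; ⌊⌋-map′)

⌊⌋-true : {A : Set} (a? : Dec A) → A → ⌊ a? ⌋ ≡ true
⌊⌋-true a? a = trans (isYes≗does a?) (dec-true a? a)

⌊⌋-false : {A : Set} (a? : Dec A) → ¬ A → ⌊ a? ⌋ ≡ false
⌊⌋-false a? ¬a = trans (isYes≗does a?) (dec-false a? ¬a)

<-by : {a b : ℕ} (k : ℕ) → suc a + k ≡ b → a < b
<-by {a} k eq = subst (a <_) eq (m≤m+n (suc a) k)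

≤-by : {a b : ℕ} (k : ℕ) → a + k ≡ b → a ≤ b
≤-by {a} k eq = subst (a ≤_) eq (m≤m+n a k)

parity : (t : ℕ) → ∃[ a ] (t ≡ 2 * a ⊎ t ≡ suc (2 * a))
parity zero = 0 , inj₁ refl
parity (suc t) with parity t
... | a , inj₁ t≡2a   = a , inj₂ (cong suc t≡2a)
... | a , inj₂ t≡1+2a = suc a , inj₁ (trans (cong suc t≡1+2a) (twice-suc a))
  where
  twice-suc : ∀ a → suc (suc (2 * a)) ≡ 2 * suc a
  twice-suc = solve-∀

module _ {n : ℕ} .{{_ : NonZero n}} where

  %-absorbˡ : (u v : ℕ) → (u % n + v) % n ≡ (u + v) % n
  %-absorbˡ u v = begin
    (u % n + v) % n            ≡⟨ %-distribˡ-+ (u % n) v n ⟩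
    (u % n % n + v % n) % n    ≡⟨ cong (λ x → (x + v % n) % n) (m%n%n≡m%n u n) ⟩
    (u % n + v % n) % n        ≡⟨ %-distribˡ-+ u v n ⟨
    (u + v) % n                ∎
    where open ≡-Reasoning

  ≡+kn⇒%≡ : {x : ℕ} (j k : ℕ) → x ≡ j + k * n → j < n → x % n ≡ j
  ≡+kn⇒%≡ j k refl j<n = trans ([m+kn]%n≡m%n j k n) (m<n⇒m%n≡m j<n)

  %-absorbʳ : (u v : ℕ) → (u + v % n) % n ≡ (u + v) % n
  %-absorbʳ u v = trans (cong (_% n) (+-comm u (v % n))) (trans (%-absorbˡ v u) (cong (_% n) (+-comm v u)))

  private
    +-inverseˡ-% : (a x : ℕ) → x < n → ((a + x) % n + (n ∸ a % n)) % n ≡ x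
    +-inverseˡ-% a x x<n = begin
      ((a + x) % n + (n ∸ a % n)) % n                ≡⟨ %-absorbˡ (a + x) (n ∸ a % n) ⟩
      (a + x + (n ∸ a % n)) % n                      ≡⟨ cong (λ y → (y + x + (n ∸ a % n)) % n) (m≡m%n+[m/n]*n a n) ⟩
      (a % n + a / n * n + x + (n ∸ a % n)) % n      ≡⟨ cong (_% n) (regroup (a % n) (a / n * n) x (n ∸ a % n)) ⟩
      (x + (a % n + (n ∸ a % n)) + a / n * n) % n    ≡⟨ cong (λ y → (x + y + a / n * n) % n) (m+[n∸m]≡n (m%n≤n a n)) ⟩
      (x + n + a / n * n) % n                        ≡⟨ [m+kn]%n≡m%n (x + n) (a / n) n ⟩
      (x + n) % n                                    ≡⟨ [m+n]%n≡m%n x n ⟩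
      x % n                                          ≡⟨ m<n⇒m%n≡m x<n ⟩
      x                                              ∎
      where
      open ≡-Reasoning
      regroup : ∀ a b c d → a + b + c + d ≡ c + (a + d) + b
      regroup = solve-∀

  +-cancelˡ-% : (a : ℕ) {x y : ℕ} → x < n → y < n → (a + x) % n ≡ (a + y) % n → x ≡ y
  +-cancelˡ-% a {x} {y} x<n y<n eq =
    trans (sym (+-inverseˡ-% a x x<n)) (trans (cong (λ z → (z + (n ∸ a % n)) % n) eq) (+-inverseˡ-% a y y<n))

module FinSums where

  private variable
    n k : ℕ

  sumFin≡sum : (f : Fin n → ℕ) → sumFin f ≡ sum f
  sumFin≡sum {zero}  f = refl
  sumFin≡sum {suc n} f = cong (f zero +_) (sumFin≡sum (f ∘ suc))

  sum-const : (k : ℕ) → sum {n} (λ _ → k) ≡ n * k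
  sum-const {zero}  k = refl
  sum-const {suc n} k = cong (k +_) (sum-const {n} k)

  sum-*ʳ : (f : Fin n → ℕ) (k : ℕ) → sum (λ i → f i * k) ≡ sum f * k
  sum-*ʳ f k = sym (*-distribʳ-sum k f)

  sum-mono : {f g : Fin n → ℕ} → (∀ i → f i ≤ g i) → sum f ≤ sum g
  sum-mono {zero}  f≤g = z≤n
  sum-mono {suc n} f≤g = +-mono-≤ (f≤g zero) (sum-mono (f≤g ∘ suc))

  sum≡0⇒≡0 : (f : Fin n → ℕ) → sum f ≡ 0 → ∀ i → f i ≡ 0
  sum≡0⇒≡0 {suc n} f eq zero    = m+n≡0⇒m≡0 (f zero) eq
  sum≡0⇒≡0 {suc n} f eq (suc i) = sum≡0⇒≡0 (f ∘ suc) (m+n≡0⇒n≡0 (f zero) eq) i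

  sum-pick : (x : Fin n) (h : Fin n → ℕ) → sum (λ i → if ⌊ x ≟ᶠ i ⌋ then h i else 0) ≡ h x
  sum-pick {suc n} zero    h = trans (cong (h zero +_) (sum-replicate-zero n)) (+-identityʳ _)
  sum-pick {suc n} (suc x) h =
    trans (sum-cong-≗ (λ i → cong (λ b → if b then h (suc i) else 0) (⌊⌋-map′ _ _ (x ≟ᶠ i)))) (sum-pick x (h ∘ suc))

  term≤sum : (h : Fin n → ℕ) (x : Fin n) → h x ≤ sum h
  term≤sum {suc n} h x = ≤-trans (m≤m+n (h x) _) (≤-reflexive (sym (sum-remove {i = x} h)))

  sum-∘-injective-≤ : (h : Fin n → ℕ) (g : Fin k → Fin n) → Injective _≡_ _≡_ g → sum (h ∘ g) ≤ sum h
  sum-∘-injective-≤ {n}     {zero}  h g _ = z≤n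
  sum-∘-injective-≤ {zero}  {suc k} h g _ = ⊥-elim (¬Fin0 (g zero))
  sum-∘-injective-≤ {suc n} {suc k} h g g-inj = begin
    h (g zero) + sum (h ∘ g ∘ suc)               ≡⟨ cong (h (g zero) +_) (sum-cong-≗ (λ i → cong h (punchIn-punchOut (g₀≢ i)))) ⟨
    h (g zero) + sum (removeAt h (g zero) ∘ g′)  ≤⟨ +-monoʳ-≤ (h (g zero)) (sum-∘-injective-≤ (removeAt h (g zero)) g′ g′-inj) ⟩
    h (g zero) + sum (removeAt h (g zero))       ≡⟨ sum-remove h ⟨
    sum h                                        ∎
    where
    open ≤-Reasoning
    g₀≢ : ∀ i → g zero ≢ g (suc i)
    g₀≢ i eq = 0≢1+n (g-inj eq)
    g′ : Fin k → Fin n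
    g′ i = punchOut (g₀≢ i)
    g′-inj : Injective _≡_ _≡_ g′
    g′-inj eq = suc-injectiveᶠ (g-inj (punchOut-injective (g₀≢ _) (g₀≢ _) eq))

  3≤sum : (h : Fin n → ℕ) {x y z : Fin n} → x ≢ y → x ≢ z → y ≢ z →
          1 ≤ h x → 1 ≤ h y → 1 ≤ h z → 3 ≤ sum h
  3≤sum {n} h {x} {y} {z} x≢y x≢z y≢z 1≤hx 1≤hy 1≤hz =
    ≤-trans (+-mono-≤ 1≤hx (+-mono-≤ 1≤hy (+-mono-≤ 1≤hz z≤n))) (sum-∘-injective-≤ h xyz xyz-inj)
    where
    xyz : Fin 3 → Fin n
    xyz = x ∷ y ∷ z ∷ []
    xyz-inj : Injective _≡_ _≡_ xyz
    xyz-inj {zero}             {zero}             _  = refl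
    xyz-inj {zero}             {suc zero}         eq = ⊥-elim (x≢y eq)
    xyz-inj {zero}             {suc (suc zero)}   eq = ⊥-elim (x≢z eq)
    xyz-inj {suc zero}         {zero}             eq = ⊥-elim (x≢y (sym eq))
    xyz-inj {suc zero}         {suc zero}         _  = refl
    xyz-inj {suc zero}         {suc (suc zero)}   eq = ⊥-elim (y≢z eq)
    xyz-inj {suc (suc zero)}   {zero}             eq = ⊥-elim (x≢z (sym eq))
    xyz-inj {suc (suc zero)}   {suc zero}         eq = ⊥-elim (y≢z (sym eq))
    xyz-inj {suc (suc zero)}   {suc (suc zero)}   _  = refl

  lowerBounds+total⇒exact : (f : Fin n → ℕ) → (∀ i → k ≤ f i) → sum f ≡ n * k → ∀ i → f i ≡ k
  lowerBounds+total⇒exact {n} {k} f k≤f total i =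
    ≤-antisym (m∸n≡0⇒m≤n (sum≡0⇒≡0 excess excess≡0 i)) (k≤f i)
    where
    excess : Fin n → ℕ
    excess j = f j ∸ k
    excess≡0 : sum excess ≡ 0
    excess≡0 = +-cancelˡ-≡ (n * k) _ _ (begin
      n * k + sum excess                ≡⟨ cong (_+ sum excess) (sum-const {n} k) ⟨
      sum {n} (λ _ → k) + sum excess    ≡⟨ ∑-distrib-+ (λ _ → k) excess ⟨
      sum (λ j → k + (f j ∸ k))         ≡⟨ sum-cong-≗ (λ j → m+[n∸m]≡n (k≤f j)) ⟩
      sum f                             ≡⟨ total ⟩
      n * k                             ≡⟨ +-identityʳ (n * k) ⟨
      n * k + 0                         ∎)
      where open ≡-Reasoning

  sum-toℕ : (n : ℕ) → 2 * sum {n} toℕ + n ≡ n * n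
  sum-toℕ zero    = refl
  sum-toℕ (suc n) = begin
    2 * sum {n} (λ i → 1 + toℕ i) + suc n  ≡⟨ cong (λ x → 2 * x + suc n) (∑-distrib-+ {n} (λ _ → 1) toℕ) ⟩
    2 * (sum {n} (λ _ → 1) + S) + suc n    ≡⟨ cong (λ x → 2 * (x + S) + suc n) (trans (sum-const {n} 1) (*-identityʳ n)) ⟩
    2 * (n + S) + suc n                    ≡⟨ regroup n S ⟩
    (2 * S + n) + (2 * n + 1)              ≡⟨ cong (_+ (2 * n + 1)) (sum-toℕ n) ⟩
    n * n + (2 * n + 1)                    ≡⟨ square n ⟩
    suc n * suc n                          ∎
    where
    open ≡-Reasoning
    S = sum {n} toℕ
    regroup : ∀ n S → 2 * (n + S) + suc n ≡ (2 * S + n) + (2 * n + 1)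
    regroup = solve-∀
    square : ∀ n → n * n + (2 * n + 1) ≡ suc n * suc n
    square = solve-∀

  count≡sum : (f : Fin n → Bool) → count f ≡ sum (λ i → if f i then 1 else 0)
  count≡sum {zero}  f = refl
  count≡sum {suc n} f = cong ((if f zero then 1 else 0) +_) (count≡sum (f ∘ suc))

  sum-if : (f : Fin n → Bool) (k : ℕ) → sum (λ i → if f i then k else 0) ≡ k * count f
  sum-if {zero}  f k = sym (*-zeroʳ k)
  sum-if {suc n} f k with f zero
  ... | true  = trans (cong (k +_) (sum-if (f ∘ suc) k)) (sym (*-suc k _))
  ... | false = sum-if (f ∘ suc) k

  count-singleton : (x : Fin n) → count (λ i → ⌊ x ≟ᶠ i ⌋) ≡ 1
  count-singleton x = trans (count≡sum (λ i → ⌊ x ≟ᶠ i ⌋)) (sum-pick x (λ _ → 1))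

  count-∨-≤ : (f g : Fin n → Bool) → count (λ i → f i ∨ g i) ≤ count f + count g
  count-∨-≤ {zero}  f g = z≤n
  count-∨-≤ {suc n} f g with f zero | g zero
  ... | true  | true  = s≤s (≤-trans (count-∨-≤ (f ∘ suc) (g ∘ suc)) (+-monoʳ-≤ (count (f ∘ suc)) (n≤1+n _)))
  ... | true  | false = s≤s (count-∨-≤ (f ∘ suc) (g ∘ suc))
  ... | false | true  = ≤-trans (s≤s (count-∨-≤ (f ∘ suc) (g ∘ suc))) (≤-reflexive (sym (+-suc _ _)))
  ... | false | false = count-∨-≤ (f ∘ suc) (g ∘ suc)

  1≤count : (f : Fin n → Bool) {x : Fin n} → f x ≡ true → 1 ≤ count f
  1≤count f {x} fx = ≤-trans (≤-reflexive (cong (λ b → if b then 1 else 0) (sym fx)))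
                             (≤-trans (term≤sum (λ i → if f i then 1 else 0) x) (≤-reflexive (sym (count≡sum f))))

  3≤count : (f : Fin n → Bool) {x y z : Fin n} → x ≢ y → x ≢ z → y ≢ z →
            f x ≡ true → f y ≡ true → f z ≡ true → 3 ≤ count f
  3≤count f x≢y x≢z y≢z fx fy fz =
    ≤-trans (3≤sum _ x≢y x≢z y≢z (one fx) (one fy) (one fz)) (≤-reflexive (sym (count≡sum f)))
    where
    one : ∀ {i} → f i ≡ true → 1 ≤ (if f i then 1 else 0)
    one fi rewrite fi = s≤s z≤n

  injective⇒surjective : (f : Fin n → Fin n) → Injective _≡_ _≡_ f → ∀ y → ∃[ x ] f x ≡ y
  injective⇒surjective {zero}  f _     ()
  injective⇒surjective {suc n} f f-inj y with any? (λ x → f x ≟ᶠ y)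
  ... | yes hit = hit
  ... | no miss = ⊥-elim (<-irrefl refl (injective⇒≤ g-inj))
    where
    f≢y : ∀ x → y ≢ f x
    f≢y x eq = miss (x , sym eq)
    g : Fin (suc n) → Fin n
    g x = punchOut (f≢y x)
    g-inj : Injective _≡_ _≡_ g
    g-inj eq = f-inj (punchOut-injective (f≢y _) (f≢y _) eq)

open FinSums

module CellSums where

  private variable
    n : ℕ

  restrict : CellSet n → (Fin n → Fin n → ℕ) → Fin n → Fin n → ℕ
  restrict P w r c = if P r c then w r c else 0

  cellSum : CellSet n → (Fin n → Fin n → ℕ) → ℕ
  cellSum P w = sum (λ r → sum (restrict P w r))

  columnCount : CellSet n → Fin n → ℕ
  columnCount P c = count (λ r → P r c)

  symbolCount : LatinSquare n → CellSet n → Fin n → ℕ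
  symbolCount L P s = sumFin (λ r → count (λ c → P r c ∧ ⌊ L r c ≟ᶠ s ⌋))

  module _ (P : CellSet n) where

    cellSum-cong : {v w : Fin n → Fin n → ℕ} → (∀ r c → v r c ≡ w r c) → cellSum P v ≡ cellSum P w
    cellSum-cong v≡w = sum-cong-≗ (λ r → sum-cong-≗ (λ c → cong (λ x → if P r c then x else 0) (v≡w r c)))

    cellSum-mono : {v w : Fin n → Fin n → ℕ} → (∀ r c → v r c ≤ w r c) → cellSum P v ≤ cellSum P w
    cellSum-mono v≤w = sum-mono (λ r → sum-mono (λ c → if-mono (P r c) (v≤w r c)))
      where
      if-mono : ∀ b {x y} → x ≤ y → (if b then x else 0) ≤ (if b then y else 0)
      if-mono true  x≤y = x≤y
      if-mono false _   = z≤n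

    cellSum-+ : (v w : Fin n → Fin n → ℕ) → cellSum P (λ r c → v r c + w r c) ≡ cellSum P v + cellSum P w
    cellSum-+ v w =
      trans (sum-cong-≗ (λ r → trans (sum-cong-≗ (λ c → if-+ (P r c))) (∑-distrib-+ (restrict P v r) (restrict P w r))))
            (∑-distrib-+ (λ r → sum (restrict P v r)) (λ r → sum (restrict P w r)))
      where
      if-+ : ∀ b {x y} → (if b then x + y else 0) ≡ (if b then x else 0) + (if b then y else 0)
      if-+ true  = refl
      if-+ false = refl

    cellSum-* : (k : ℕ) (w : Fin n → Fin n → ℕ) → cellSum P (λ r c → k * w r c) ≡ k * cellSum P w
    cellSum-* k w = sym (trans (*-distribˡ-sum k (λ r → sum (restrict P w r)))
                               (sum-cong-≗ (λ r → trans (*-distribˡ-sum k (restrict P w r)) (sum-cong-≗ (λ c → if-* (P r c))))))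
      where
      if-* : ∀ b {x} → k * (if b then x else 0) ≡ (if b then k * x else 0)
      if-* true  = refl
      if-* false = *-zeroʳ k

    cellSum-row : (g : Fin n → ℕ) → cellSum P (λ r _ → g r) ≡ sum (λ r → g r * count (P r))
    cellSum-row g = sum-cong-≗ (λ r → sum-if (P r) (g r))

    cellSum-column : (g : Fin n → ℕ) → cellSum P (λ _ c → g c) ≡ sum (λ c → g c * columnCount P c)
    cellSum-column g = trans (∑-comm (restrict P (λ _ c → g c))) (sum-cong-≗ (λ c → sum-if (λ r → P r c) (g c)))

    cellSum-symbol : (L : LatinSquare n) (h : Fin n → ℕ) →
                     cellSum P (λ r c → h (L r c)) ≡ sum (λ s → h s * symbolCount L P s)
    cellSum-symbol L h = sym (begin
      sum (λ s → h s * symbolCount L P s)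
        ≡⟨ sum-cong-≗ (λ s → trans (cong (h s *_) (sumFin≡sum (λ r → hits r s))) (*-distribˡ-sum (h s) (λ r → hits r s))) ⟩
      sum (λ s → sum (λ r → h s * hits r s))
        ≡⟨ sum-cong-≗ (λ s → sum-cong-≗ (λ r → sum-if (λ c → P r c ∧ ⌊ L r c ≟ᶠ s ⌋) (h s))) ⟨
      sum (λ s → sum (λ r → sum (λ c → weight s r c)))
        ≡⟨ ∑-comm (λ s r → sum (weight s r)) ⟩
      sum (λ r → sum (λ s → sum (λ c → weight s r c)))
        ≡⟨ sum-cong-≗ (λ r → trans (∑-comm (λ s → weight s r)) (sum-cong-≗ (λ c → pick (P r c) (L r c)))) ⟩
      cellSum P (λ r c → h (L r c))
        ∎)
      where
      open ≡-Reasoning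
      hits : Fin n → Fin n → ℕ
      hits r s = count (λ c → P r c ∧ ⌊ L r c ≟ᶠ s ⌋)
      weight : Fin n → Fin n → Fin n → ℕ
      weight s r c = if P r c ∧ ⌊ L r c ≟ᶠ s ⌋ then h s else 0
      pick : ∀ b x → sum (λ s → if b ∧ ⌊ x ≟ᶠ s ⌋ then h s else 0) ≡ (if b then h x else 0)
      pick true  x = sum-pick x h
      pick false x = sum-replicate-zero n

    module _ {k : ℕ} (rows : ∀ r → count (P r) ≡ k) where

      cellSum-rowWeights : (g : Fin n → ℕ) → cellSum P (λ r _ → g r) ≡ sum g * k
      cellSum-rowWeights g = trans (cellSum-row g) (trans (sum-cong-≗ (λ r → cong (g r *_) (rows r))) (sum-*ʳ g k))

      cellSum-ones : cellSum P (λ _ _ → 1) ≡ n * k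
      cellSum-ones = trans (cellSum-rowWeights (λ _ → 1)) (trans (cong (_* k) (sum-const {n} 1)) (cong (_* k) (*-identityʳ n)))

      plex-of-lowerBounds : (L : LatinSquare n) → (∀ c → k ≤ columnCount P c) → (∀ s → k ≤ symbolCount L P s) → IsPlex k L P
      plex-of-lowerBounds L columns≥ symbols≥ =
          rows
        , lowerBounds+total⇒exact (columnCount P) columns≥ (total (columnCount P) (cellSum-column (λ _ → 1)))
        , lowerBounds+total⇒exact (symbolCount L P) symbols≥ (total (symbolCount L P) (cellSum-symbol L (λ _ → 1)))
        where
        total : (f : Fin n → ℕ) → cellSum P (λ _ _ → 1) ≡ sum (λ i → 1 * f i) → sum f ≡ n * k
        total f eq = trans (sum-cong-≗ (λ i → sym (*-identityˡ (f i)))) (trans (sym eq) cellSum-ones)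

  module _ (L : LatinSquare n) (P : CellSet n) {k : ℕ} (plex : IsPlex k L P) where

    plex-rowSum : (g : Fin n → ℕ) → cellSum P (λ r _ → g r) ≡ sum g * k
    plex-rowSum = cellSum-rowWeights P (proj₁ plex)

    plex-columnSum : (g : Fin n → ℕ) → cellSum P (λ _ c → g c) ≡ sum g * k
    plex-columnSum g = trans (cellSum-column P g) (trans (sum-cong-≗ (λ c → cong (g c *_) (proj₁ (proj₂ plex) c))) (sum-*ʳ g k))

    plex-symbolSum : (h : Fin n → ℕ) → cellSum P (λ r c → h (L r c)) ≡ sum h * k
    plex-symbolSum h = trans (cellSum-symbol P L h) (trans (sum-cong-≗ (λ s → cong (h s *_) (proj₂ (proj₂ plex) s))) (sum-*ʳ h k))

  3≤symbolCount : (L : LatinSquare n) (P : CellSet n) {r₁ r₂ r₃ s c₁ c₂ c₃ : Fin n} →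
                  r₁ ≢ r₂ → r₁ ≢ r₃ → r₂ ≢ r₃ →
                  P r₁ c₁ ≡ true → P r₂ c₂ ≡ true → P r₃ c₃ ≡ true →
                  L r₁ c₁ ≡ s → L r₂ c₂ ≡ s → L r₃ c₃ ≡ s → 3 ≤ symbolCount L P s
  3≤symbolCount L P {s = s} r₁≢r₂ r₁≢r₃ r₂≢r₃ h₁ h₂ h₃ e₁ e₂ e₃ =
    ≤-trans (3≤sum hits r₁≢r₂ r₁≢r₃ r₂≢r₃ (one h₁ e₁) (one h₂ e₂) (one h₃ e₃))
            (≤-reflexive (sym (sumFin≡sum hits)))
    where
    hits : Fin _ → ℕ
    hits r = count (λ c → P r c ∧ ⌊ L r c ≟ᶠ s ⌋)
    one : ∀ {r c} → P r c ≡ true → L r c ≡ s → 1 ≤ hits r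
    one {r} {c} Prc Lrc≡s =
      1≤count (λ c → P r c ∧ ⌊ L r c ≟ᶠ s ⌋) (cong₂ _∧_ Prc (⌊⌋-true (L r c ≟ᶠ s) Lrc≡s))

  latin-of-injective : (L : LatinSquare n) →
                       (∀ r → Injective _≡_ _≡_ (L r)) → (∀ c → Injective _≡_ _≡_ (λ r → L r c)) → IsLatin L
  latin-of-injective {n} L rows columns = (λ r → unique (L r) (rows r)) , (λ c → unique (λ r → L r c) (columns c))
    where
    unique : (f : Fin n → Fin n) → Injective _≡_ _≡_ f → ∀ y → ∃[ x ] (f x ≡ y × (∀ x′ → f x′ ≡ y → x′ ≡ x))
    unique f f-inj y with injective⇒surjective f f-inj y
    ... | x , fx≡y = x , fx≡y , λ x′ fx′≡y → f-inj (trans fx′≡y (sym fx≡y))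

open CellSums

-- The identity `balance` below, together with 2S + n = n², for n = 4m.
transversal-balance-impossible : (m : ℕ) .{{_ : NonZero m}} {S Q a b : ℕ} → a ≤ 1 → b ≤ 1 →
  2 * S + m * 4 ≡ m * 4 * (m * 4) → S + m * 4 * Q + m * a ≡ S + m * b + S → ⊥
transversal-balance-impossible m {S} {Q} {a} {b} a≤1 b≤1 gauss balance = residues a≤1 b≤1 (begin
  (2 + a) % 4                 ≡⟨ [m+kn]%n≡m%n (2 + a) Q 4 ⟨
  (2 + a + Q * 4) % 4         ≡⟨ cong (_% 4) quarter ⟩
  (b + m * 2 * 4) % 4         ≡⟨ [m+kn]%n≡m%n b (m * 2) 4 ⟩
  b % 4                       ∎)
  where
  open ≡-Reasoning
  reduced : m * 4 * Q + m * a ≡ m * b + S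
  reduced = +-cancelˡ-≡ S _ _ (trans (sym (+-assoc S (m * 4 * Q) (m * a))) (trans balance (+-assoc S (m * b) S)))
  doubled : m * (2 * (2 + a + Q * 4)) ≡ m * (2 * (b + m * 2 * 4))
  doubled = begin
    m * (2 * (2 + a + Q * 4))         ≡⟨ expand₁ m a Q ⟩
    2 * (m * 4 * Q + m * a) + m * 4   ≡⟨ cong (λ x → 2 * x + m * 4) reduced ⟩
    2 * (m * b + S) + m * 4           ≡⟨ expand₂ m b S ⟩
    2 * (m * b) + (2 * S + m * 4)     ≡⟨ cong (2 * (m * b) +_) gauss ⟩
    2 * (m * b) + m * 4 * (m * 4)     ≡⟨ expand₃ m b ⟩
    m * (2 * (b + m * 2 * 4))         ∎
    where
    expand₁ : ∀ m a Q → m * (2 * (2 + a + Q * 4)) ≡ 2 * (m * 4 * Q + m * a) + m * 4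
    expand₁ = solve-∀
    expand₂ : ∀ m b S → 2 * (m * b + S) + m * 4 ≡ 2 * (m * b) + (2 * S + m * 4)
    expand₂ = solve-∀
    expand₃ : ∀ m b → 2 * (m * b) + m * 4 * (m * 4) ≡ m * (2 * (b + m * 2 * 4))
    expand₃ = solve-∀
  quarter : 2 + a + Q * 4 ≡ b + m * 2 * 4
  quarter = *-cancelˡ-≡ _ _ 2 (*-cancelˡ-≡ _ _ m doubled)
  residues : ∀ {a b} → a ≤ 1 → b ≤ 1 → (2 + a) % 4 ≢ b % 4
  residues z≤n       z≤n       ()
  residues z≤n       (s≤s z≤n) ()
  residues (s≤s z≤n) z≤n       ()
  residues (s≤s z≤n) (s≤s z≤n) ()

module TurnedCyclic (p : ℕ) where

  m n last : ℕ
  m = 2 + p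
  n = m * 4
  last = 3 * m + suc p

  -- Only ever used as propositions; opaque so that their ring-solver proofs are never unfolded.
  opaque
    m<n : m < n
    m<n = <-by (3 * p + 5) (eq p)
      where
      eq : ∀ p → suc (2 + p) + (3 * p + 5) ≡ (2 + p) * 4
      eq = solve-∀

    m<2m : m < 2 * m
    m<2m = <-by (suc p) (eq p)
      where
      eq : ∀ p → suc (2 + p) + suc p ≡ 2 * (2 + p)
      eq = solve-∀

    m<3m : m < 3 * m
    m<3m = <-by (suc (2 * p + 2)) (eq p)
      where
      eq : ∀ p → suc (2 + p) + suc (2 * p + 2) ≡ 3 * (2 + p)
      eq = solve-∀

    2m<n : 2 * m < n
    2m<n = <-by (suc (2 * p + 2)) (eq p)
      where
      eq : ∀ p → suc (2 * (2 + p)) + suc (2 * p + 2) ≡ (2 + p) * 4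
      eq = solve-∀

    3m<n : 3 * m < n
    3m<n = <-by (suc p) (eq p)
      where
      eq : ∀ p → suc (3 * (2 + p)) + suc p ≡ (2 + p) * 4
      eq = solve-∀

    suc-m<n : suc m < n
    suc-m<n = <-by (3 * p + 4) (eq p)
      where
      eq : ∀ p → suc (suc (2 + p)) + (3 * p + 4) ≡ (2 + p) * 4
      eq = solve-∀

    suc-last≡n : suc last ≡ n
    suc-last≡n = eq p
      where
      eq : ∀ p → suc (3 * (2 + p) + suc p) ≡ (2 + p) * 4
      eq = solve-∀

    last<n : last < n
    last<n = <-by 0 (eq p)
      where
      eq : ∀ p → suc (3 * (2 + p) + suc p) + 0 ≡ (2 + p) * 4
      eq = solve-∀

    m≢last : m ≢ last
    m≢last = <⇒≢ (<-by (2 * m + p) (eq p))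
      where
      eq : ∀ p → suc (2 + p) + (2 * (2 + p) + p) ≡ 3 * (2 + p) + suc p
      eq = solve-∀

    2m≤last : 2 * m ≤ last
    2m≤last = ≤-by (m + suc p) (eq p)
      where
      eq : ∀ p → 2 * (2 + p) + ((2 + p) + suc p) ≡ 3 * (2 + p) + suc p
      eq = solve-∀

    half< : ∀ {a} → 2 * a < n → a < 2 * m
    half< {a} 2a<n = *-cancelˡ-< 2 a (2 * m) (subst (2 * a <_) (eq m) 2a<n)
      where
      eq : ∀ m → m * 4 ≡ 2 * (2 * m)
      eq = solve-∀

    +2m<n : ∀ {a} → a < 2 * m → a + 2 * m < n
    +2m<n {a} a<2m = subst (a + 2 * m <_) (eq m) (+-monoˡ-< (2 * m) a<2m)
      where
      eq : ∀ m → 2 * m + 2 * m ≡ m * 4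
      eq = solve-∀

  ι : ℕ → Fin n
  ι x = x mod n

  toℕ-ι : (x : ℕ) → x < n → toℕ (ι x) ≡ x
  toℕ-ι x x<n = trans (toℕ-fromℕ< _) (m<n⇒m%n≡m x<n)

  rowm : Fin n
  rowm = fromℕ< m<n

  multipleOfm : ℕ → Bool
  multipleOfm x = does (x % m ≟ 0)

  multipleOfm-+ : {a : ℕ} (x : ℕ) → m ∣ a → multipleOfm ((a + x) % n) ≡ multipleOfm x
  multipleOfm-+ {a} x m∣a = cong (λ y → does (y ≟ 0))
    (trans (m∣n⇒o%n%m≡o%m m n (a + x) (m∣m*n 4)) (%-remove-+ˡ x m∣a))

  swapIf : Bool → Fin n → Fin n
  swapIf b = if b then transpose zero rowm else id

  L : LatinSquare n
  L r c = ι (toℕ (swapIf (multipleOfm (toℕ c)) r) + toℕ c)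

  toℕ-L : ∀ r c → toℕ (L r c) ≡ (toℕ (swapIf (multipleOfm (toℕ c)) r) + toℕ c) % n
  toℕ-L r c = toℕ-fromℕ< _

  transpose-rowm : transpose zero rowm rowm ≡ zero
  transpose-rowm rewrite dec-true (rowm ≟ᶠ rowm) refl = refl

  transpose-other : ∀ {r} → r ≢ zero → r ≢ rowm → transpose zero rowm r ≡ r
  transpose-other {r} r≢0 r≢m rewrite dec-false (r ≟ᶠ zero) r≢0 | dec-false (r ≟ᶠ rowm) r≢m = refl

  data RowKind : Fin n → Set where
    row-0    : RowKind zero
    row-m    : RowKind rowm
    ordinary : ∀ {r} → r ≢ zero → r ≢ rowm → RowKind r

  rowKind : ∀ r → RowKind r
  rowKind r with r ≟ᶠ zero | r ≟ᶠ rowm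
  ... | yes refl | _        = row-0
  ... | no _     | yes refl = row-m
  ... | no r≢0   | no r≢m   = ordinary r≢0 r≢m

  swapIf-injective : ∀ b → Injective _≡_ _≡_ (swapIf b)
  swapIf-injective true  eq = trans (sym (transpose-inverse rowm zero)) (trans (cong (transpose rowm zero) eq) (transpose-inverse rowm zero))
  swapIf-injective false eq = eq

  swapIf-shift : ∀ r → toℕ (swapIf true r) ≡ toℕ (swapIf false r) ⊎ (∀ b → m ∣ toℕ (swapIf b r))
  swapIf-shift r with rowKind r
  ... | row-0  = inj₂ λ { true  → subst (m ∣_) (sym (toℕ-fromℕ< m<n)) ∣-refl
                        ; false → m ∣0 }
  ... | row-m  = inj₂ λ { true  → subst (m ∣_) (sym (cong toℕ transpose-rowm)) (m ∣0)
                        ; false → subst (m ∣_) (sym (toℕ-fromℕ< m<n)) ∣-refl }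
  ... | ordinary r≢0 r≢m = inj₁ (cong toℕ (transpose-other r≢0 r≢m))

  L-row-injective : ∀ r → Injective _≡_ _≡_ (L r)
  L-row-injective r {c} {c′} eq = toℕ-injective (+-cancelˡ-% (shift (B c′)) (toℕ<n c) (toℕ<n c′) (begin
    (shift (B c′) + toℕ c) % n   ≡⟨ cong (λ a → (a + toℕ c) % n) same-shift ⟨
    (shift (B c) + toℕ c) % n    ≡⟨ toℕ-L r c ⟨
    toℕ (L r c)                  ≡⟨ cong toℕ eq ⟩
    toℕ (L r c′)                 ≡⟨ toℕ-L r c′ ⟩
    (shift (B c′) + toℕ c′) % n  ∎))
    where
    open ≡-Reasoning
    B : Fin n → Bool
    B c = multipleOfm (toℕ c)
    shift : Bool → ℕ
    shift b = toℕ (swapIf b r)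
    same-shift : shift (B c) ≡ shift (B c′)
    same-shift with swapIf-shift r
    ... | inj₁ ignores = ignores-bool (B c) (B c′)
      where
      ignores-bool : ∀ b b′ → shift b ≡ shift b′
      ignores-bool true  true  = refl
      ignores-bool true  false = ignores
      ignores-bool false true  = sym ignores
      ignores-bool false false = refl
    ... | inj₂ divisible = cong shift (begin
      B c                                      ≡⟨ multipleOfm-+ (toℕ c) (divisible (B c)) ⟨
      multipleOfm ((shift (B c) + toℕ c) % n)   ≡⟨ cong multipleOfm (trans (sym (toℕ-L r c)) (trans (cong toℕ eq) (toℕ-L r c′))) ⟩
      multipleOfm ((shift (B c′) + toℕ c′) % n) ≡⟨ multipleOfm-+ (toℕ c′) (divisible (B c′)) ⟩
      B c′                                     ∎)

  L-column-injective : ∀ c → Injective _≡_ _≡_ (λ r → L r c)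
  L-column-injective c {r} {r′} eq = swapIf-injective (multipleOfm (toℕ c)) (toℕ-injective
    (+-cancelˡ-% (toℕ c) (toℕ<n (σ r)) (toℕ<n (σ r′)) (begin
      (toℕ c + toℕ (σ r)) % n   ≡⟨ cong (_% n) (+-comm (toℕ c) (toℕ (σ r))) ⟩
      (toℕ (σ r) + toℕ c) % n   ≡⟨ toℕ-L r c ⟨
      toℕ (L r c)               ≡⟨ cong toℕ eq ⟩
      toℕ (L r′ c)              ≡⟨ toℕ-L r′ c ⟩
      (toℕ (σ r′) + toℕ c) % n  ≡⟨ cong (_% n) (+-comm (toℕ (σ r′)) (toℕ c)) ⟩
      (toℕ c + toℕ (σ r′)) % n  ∎)))
    where
    open ≡-Reasoning
    σ : Fin n → Fin n
    σ = swapIf (multipleOfm (toℕ c))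

  L-latin : IsLatin L
  L-latin = latin-of-injective L L-row-injective L-column-injective

  -- No transversal

  indicator : Bool → ℕ
  indicator b = if b then 1 else 0

  turnedAt : Fin n → Fin n → Fin n → Bool
  turnedAt x r c = multipleOfm (toℕ c) ∧ ⌊ x ≟ᶠ r ⌋

  swap-defect : ∀ r c → toℕ (swapIf (multipleOfm (toℕ c)) r) + m * indicator (turnedAt rowm r c)
                        ≡ toℕ r + m * indicator (turnedAt zero r c)
  swap-defect r c with multipleOfm (toℕ c)
  ... | false = refl
  ... | true with rowKind r
  ...   | row-0  = begin
    toℕ rowm + m * 0   ≡⟨ cong (λ x → x + m * 0) (toℕ-fromℕ< m<n) ⟩
    m + m * 0          ≡⟨ trade m ⟩
    0 + m * 1          ∎
    where
    open ≡-Reasoning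
    trade : ∀ m → m + m * 0 ≡ 0 + m * 1
    trade = solve-∀
  ...   | row-m  = begin
    toℕ (transpose zero rowm rowm) + m * indicator ⌊ rowm ≟ᶠ rowm ⌋
      ≡⟨ cong₂ (λ x y → toℕ x + m * indicator y) transpose-rowm (⌊⌋-true (rowm ≟ᶠ rowm) refl) ⟩
    0 + m * 1          ≡⟨ trade m ⟩
    m + m * 0          ≡⟨ cong (λ x → x + m * 0) (toℕ-fromℕ< m<n) ⟨
    toℕ rowm + m * 0   ∎
    where
    open ≡-Reasoning
    trade : ∀ m → 0 + m * 1 ≡ m + m * 0
    trade = solve-∀
  ...   | ordinary r≢0 r≢m = cong₂ _+_ (cong toℕ (transpose-other r≢0 r≢m))
    (cong (λ x → m * indicator x) (trans (⌊⌋-false (rowm ≟ᶠ r) (r≢m ∘ sym)) (sym (⌊⌋-false (zero ≟ᶠ r) (r≢0 ∘ sym)))))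

  module _ {P : CellSet n} (transversal : IsPlex 1 L P) where

    private
      S Q a b : ℕ
      S = sum {n} toℕ
      σ : Fin n → Fin n → Fin n
      σ r c = swapIf (multipleOfm (toℕ c)) r
      quotient : Fin n → Fin n → ℕ
      quotient r c = (toℕ (σ r c) + toℕ c) / n
      Q = cellSum P quotient
      entry turnedᵐ turned⁰ : Fin n → Fin n → ℕ
      entry r c = toℕ (L r c)
      turnedᵐ r c = indicator (turnedAt rowm r c)
      turned⁰ r c = indicator (turnedAt zero r c)
      a = cellSum P turnedᵐ
      b = cellSum P turned⁰

      turned≤1 : ∀ x → cellSum P (λ r c → indicator (turnedAt x r c)) ≤ 1
      turned≤1 x = begin
        cellSum P (λ r c → indicator (turnedAt x r c))  ≤⟨ cellSum-mono P (λ r c → ∧-≤ (multipleOfm (toℕ c)) ⌊ x ≟ᶠ r ⌋) ⟩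
        cellSum P (λ r _ → indicator ⌊ x ≟ᶠ r ⌋)        ≡⟨ plex-rowSum L P transversal (λ r → indicator ⌊ x ≟ᶠ r ⌋) ⟩
        sum (λ r → indicator ⌊ x ≟ᶠ r ⌋) * 1            ≡⟨ cong (_* 1) (sum-pick x (λ _ → 1)) ⟩
        1                                               ∎
        where
        open ≤-Reasoning
        ∧-≤ : ∀ u v → indicator (u ∧ v) ≤ indicator v
        ∧-≤ true  v = ≤-refl
        ∧-≤ false v = z≤n

      cell-balance : ∀ r c → entry r c + n * quotient r c + m * turnedᵐ r c ≡ toℕ r + m * turned⁰ r c + toℕ c
      cell-balance r c = begin
        toℕ (L r c) + n * quotient r c + m * turnedᵐ r c
          ≡⟨ cong (_+ m * turnedᵐ r c)
                  (trans (cong₂ _+_ (toℕ-L r c) (*-comm n (quotient r c))) (sym (m≡m%n+[m/n]*n (toℕ (σ r c) + toℕ c) n))) ⟩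
        toℕ (σ r c) + toℕ c + m * turnedᵐ r c
          ≡⟨ swap-+ (toℕ (σ r c)) (toℕ c) (m * turnedᵐ r c) ⟩
        toℕ (σ r c) + m * turnedᵐ r c + toℕ c
          ≡⟨ cong (_+ toℕ c) (swap-defect r c) ⟩
        toℕ r + m * turned⁰ r c + toℕ c
          ∎
        where
        open ≡-Reasoning
        swap-+ : ∀ x y z → x + y + z ≡ x + z + y
        swap-+ = solve-∀

      balance : S + n * Q + m * a ≡ S + m * b + S
      balance = begin
        S + n * Q + m * a
          ≡⟨ cong₂ (λ x y → x + n * Q + y) (sym (trans (plex-symbolSum L P transversal toℕ) (*-identityʳ S)))
                                           (sym (cellSum-* P m turnedᵐ)) ⟩
        cellSum P entry + n * Q + cellSum P (λ r c → m * turnedᵐ r c)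
          ≡⟨ cong (λ x → cellSum P entry + x + cellSum P (λ r c → m * turnedᵐ r c)) (sym (cellSum-* P n quotient)) ⟩
        cellSum P entry + cellSum P (λ r c → n * quotient r c) + cellSum P (λ r c → m * turnedᵐ r c)
          ≡⟨ cong (_+ cellSum P (λ r c → m * turnedᵐ r c)) (cellSum-+ P entry (λ r c → n * quotient r c)) ⟨
        cellSum P (λ r c → entry r c + n * quotient r c) + cellSum P (λ r c → m * turnedᵐ r c)
          ≡⟨ cellSum-+ P (λ r c → entry r c + n * quotient r c) (λ r c → m * turnedᵐ r c) ⟨
        cellSum P (λ r c → entry r c + n * quotient r c + m * turnedᵐ r c)
          ≡⟨ cellSum-cong P cell-balance ⟩
        cellSum P (λ r c → toℕ r + m * turned⁰ r c + toℕ c)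
          ≡⟨ cellSum-+ P (λ r c → toℕ r + m * turned⁰ r c) (λ _ c → toℕ c) ⟩
        cellSum P (λ r c → toℕ r + m * turned⁰ r c) + cellSum P (λ _ c → toℕ c)
          ≡⟨ cong (_+ cellSum P (λ _ c → toℕ c)) (cellSum-+ P (λ r _ → toℕ r) (λ r c → m * turned⁰ r c)) ⟩
        cellSum P (λ r _ → toℕ r) + cellSum P (λ r c → m * turned⁰ r c) + cellSum P (λ _ c → toℕ c)
          ≡⟨ cong₂ (λ x y → x + cellSum P (λ r c → m * turned⁰ r c) + y)
                   (trans (plex-rowSum L P transversal toℕ) (*-identityʳ S))
                   (trans (plex-columnSum L P transversal toℕ) (*-identityʳ S)) ⟩
        S + cellSum P (λ r c → m * turned⁰ r c) + S
          ≡⟨ cong (λ x → S + x + S) (cellSum-* P m turned⁰) ⟩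
        S + m * b + S
          ∎
        where open ≡-Reasoning

    no-transversal : ⊥
    no-transversal = transversal-balance-impossible m {S} {Q} {a} {b} (turned≤1 rowm) (turned≤1 zero) (sum-toℕ n) balance

  L-no-transversal : ¬ HasTransversal L
  L-no-transversal (P , transversal) = no-transversal {P} transversal

  -- A triplex

  data Layer : Set where
    ℓ₁ ℓ₂ ℓ₃ : Layer

  -- Outside rows 0 and m the three layers carry the symbols 2y + 1, 2y, and 2y + m + 1 or 2y + m + 2.
  offset : Layer → ℕ → ℕ
  offset ℓ₁ y = 1
  offset ℓ₂ y = if does (y ≟ 0) then suc m else 0
  offset ℓ₃ y = if does (y ≟ 0) then suc (3 * m)
                else if does (y ≟ m) then 3 * m
                else if does (y ≟ last) then 2 + 2 * m
                else if does (y <? 2 * m) then suc m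
                else 2 + m

  offset₂-≢0 : ∀ {y} → y ≢ 0 → offset ℓ₂ y ≡ 0
  offset₂-≢0 {y} y≢0 rewrite dec-false (y ≟ 0) y≢0 = refl

  offset₃-m : offset ℓ₃ m ≡ 3 * m
  offset₃-m rewrite dec-true (m ≟ m) refl = refl

  offset₃-last : offset ℓ₃ last ≡ 2 + 2 * m
  offset₃-last rewrite dec-false (last ≟ m) (m≢last ∘ sym) | dec-true (last ≟ last) refl = refl

  offset₃-low : ∀ {y} → y ≢ 0 → y ≢ m → y < 2 * m → offset ℓ₃ y ≡ suc m
  offset₃-low {y} y≢0 y≢m y<2m
    rewrite dec-false (y ≟ 0) y≢0 | dec-false (y ≟ m) y≢m | dec-false (y ≟ last) (<⇒≢ (<-≤-trans y<2m 2m≤last))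
          | dec-true (y <? 2 * m) y<2m = refl

  offset₃-high : ∀ {y} → 2 * m ≤ y → y < last → offset ℓ₃ y ≡ 2 + m
  offset₃-high {y} 2m≤y y<last
    rewrite dec-false (y ≟ 0) (λ y≡0 → <⇒≱ (s≤s z≤n) (subst (2 * m ≤_) y≡0 2m≤y))
          | dec-false (y ≟ m) (λ y≡m → <⇒≱ m<2m (subst (2 * m ≤_) y≡m 2m≤y))
          | dec-false (y ≟ last) (<⇒≢ y<last)
          | dec-false (y <? 2 * m) (≤⇒≯ 2m≤y) = refl

  offset-<n : ∀ k y → offset k y < n
  offset-<n ℓ₁ y = s≤s (s≤s z≤n)
  offset-<n ℓ₂ y with does (y ≟ 0)
  ... | true  = suc-m<n
  ... | false = s≤s z≤n
  offset-<n ℓ₃ y with does (y ≟ 0) | does (y ≟ m) | does (y ≟ last) | does (y <? 2 * m)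
  ... | true  | _     | _     | _     = <-by p (eq p)
    where
    eq : ∀ p → suc (suc (3 * (2 + p))) + p ≡ (2 + p) * 4
    eq = solve-∀
  ... | false | true  | _     | _     = <-by (suc p) (eq p)
    where
    eq : ∀ p → suc (3 * (2 + p)) + suc p ≡ (2 + p) * 4
    eq = solve-∀
  ... | false | false | true  | _     = <-by (2 * p + 1) (eq p)
    where
    eq : ∀ p → suc (2 + 2 * (2 + p)) + (2 * p + 1) ≡ (2 + p) * 4
    eq = solve-∀
  ... | false | false | false | true  = suc-m<n
  ... | false | false | false | false = <-by (3 * p + 3) (eq p)
    where
    eq : ∀ p → suc (2 + (2 + p)) + (3 * p + 3) ≡ (2 + p) * 4
    eq = solve-∀

  3≤offset₃ : ∀ y → 3 ≤ offset ℓ₃ y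
  3≤offset₃ y with does (y ≟ 0) | does (y ≟ m) | does (y ≟ last) | does (y <? 2 * m)
  ... | true  | _     | _     | _     = m≤n⇒m≤1+n (*-monoʳ-≤ 3 {1} {m} (s≤s z≤n))
  ... | false | true  | _     | _     = *-monoʳ-≤ 3 {1} {m} (s≤s z≤n)
  ... | false | false | true  | _     = s≤s (s≤s (s≤s z≤n))
  ... | false | false | false | true  = s≤s (s≤s (s≤s z≤n))
  ... | false | false | false | false = s≤s (s≤s (s≤s z≤n))

  1≢offset₂ : ∀ y → 1 ≢ offset ℓ₂ y
  1≢offset₂ y with does (y ≟ 0)
  ... | true  = λ ()
  ... | false = λ ()

  offset₂≢offset₃ : ∀ y → offset ℓ₂ y ≢ offset ℓ₃ y
  offset₂≢offset₃ y with y ≟ 0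
  ... | yes refl = <⇒≢ (s≤s m<3m)
  ... | no y≢0   = λ eq → <⇒≢ (≤-trans (s≤s z≤n) (3≤offset₃ y)) (trans (sym (offset₂-≢0 y≢0)) eq)

  offset-injective : ∀ {k k′} y → offset k y ≡ offset k′ y → k ≡ k′
  offset-injective {ℓ₁} {ℓ₁} y eq = refl
  offset-injective {ℓ₂} {ℓ₂} y eq = refl
  offset-injective {ℓ₃} {ℓ₃} y eq = refl
  offset-injective {ℓ₁} {ℓ₂} y eq = ⊥-elim (1≢offset₂ y eq)
  offset-injective {ℓ₂} {ℓ₁} y eq = ⊥-elim (1≢offset₂ y (sym eq))
  offset-injective {ℓ₁} {ℓ₃} y eq = ⊥-elim (<⇒≢ (≤-trans (s≤s (s≤s z≤n)) (3≤offset₃ y)) eq)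
  offset-injective {ℓ₃} {ℓ₁} y eq = ⊥-elim (<⇒≢ (≤-trans (s≤s (s≤s z≤n)) (3≤offset₃ y)) (sym eq))
  offset-injective {ℓ₂} {ℓ₃} y eq = ⊥-elim (offset₂≢offset₃ y eq)
  offset-injective {ℓ₃} {ℓ₂} y eq = ⊥-elim (offset₂≢offset₃ y (sym eq))

  cell : Layer → Fin n → Fin n
  cell k r = ι (toℕ r + offset k (toℕ r))

  toℕ-cell : ∀ k r → toℕ (cell k r) ≡ (toℕ r + offset k (toℕ r)) % n
  toℕ-cell k r = toℕ-fromℕ< _

  cell-injective : ∀ {k k′} r → cell k r ≡ cell k′ r → k ≡ k′
  cell-injective {k} {k′} r eq = offset-injective (toℕ r)
    (+-cancelˡ-% (toℕ r) (offset-<n k (toℕ r)) (offset-<n k′ (toℕ r))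
                 (trans (sym (toℕ-cell k r)) (trans (cong toℕ eq) (toℕ-cell k′ r))))

  triplex : CellSet n
  triplex r c = ⌊ cell ℓ₁ r ≟ᶠ c ⌋ ∨ ⌊ cell ℓ₂ r ≟ᶠ c ⌋ ∨ ⌊ cell ℓ₃ r ≟ᶠ c ⌋

  triplex-cell : ∀ k r → triplex r (cell k r) ≡ true
  triplex-cell ℓ₁ r rewrite ⌊⌋-true (cell ℓ₁ r ≟ᶠ cell ℓ₁ r) refl = refl
  triplex-cell ℓ₂ r rewrite ⌊⌋-true (cell ℓ₂ r ≟ᶠ cell ℓ₂ r) refl = ∨-zeroʳ _
  triplex-cell ℓ₃ r rewrite ⌊⌋-true (cell ℓ₃ r ≟ᶠ cell ℓ₃ r) refl
                          | ∨-zeroʳ ⌊ cell ℓ₂ r ≟ᶠ cell ℓ₃ r ⌋ = ∨-zeroʳ _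

  ℓ₁≢ℓ₂ : ℓ₁ ≢ ℓ₂
  ℓ₁≢ℓ₂ ()
  ℓ₁≢ℓ₃ : ℓ₁ ≢ ℓ₃
  ℓ₁≢ℓ₃ ()
  ℓ₂≢ℓ₃ : ℓ₂ ≢ ℓ₃
  ℓ₂≢ℓ₃ ()

  triplex-row : ∀ r → count (triplex r) ≡ 3
  triplex-row r = ≤-antisym at-most-3
    (3≤count (triplex r) (ℓ₁≢ℓ₂ ∘ cell-injective r) (ℓ₁≢ℓ₃ ∘ cell-injective r) (ℓ₂≢ℓ₃ ∘ cell-injective r)
             (triplex-cell ℓ₁ r) (triplex-cell ℓ₂ r) (triplex-cell ℓ₃ r))
    where
    open ≤-Reasoning
    is : Layer → Fin n → Bool
    is k c = ⌊ cell k r ≟ᶠ c ⌋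
    at-most-3 : count (triplex r) ≤ 3
    at-most-3 = begin
      count (triplex r)                                   ≤⟨ count-∨-≤ (is ℓ₁) (λ c → is ℓ₂ c ∨ is ℓ₃ c) ⟩
      count (is ℓ₁) + count (λ c → is ℓ₂ c ∨ is ℓ₃ c)     ≤⟨ +-monoʳ-≤ (count (is ℓ₁)) (count-∨-≤ (is ℓ₂) (is ℓ₃)) ⟩
      count (is ℓ₁) + (count (is ℓ₂) + count (is ℓ₃))     ≡⟨ cong₂ _+_ (singleton ℓ₁) (cong₂ _+_ (singleton ℓ₂) (singleton ℓ₃)) ⟩
      3                                                   ∎
      where
      singleton : ∀ k → count (is k) ≡ 1
      singleton k = count-singleton (cell k r)

  record Spot (Hit : Fin n → Layer → Set) : Set where
    constructor spot
    field
      row   : ℕ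
      layer : Layer
      row<n : row < n
      hit   : Hit (ι row) layer

  open Spot

  position : ∀ {Hit} → Spot Hit → ℕ × Layer
  position s = row s , layer s

  record Witnesses (Hit : Fin n → Layer → Set) : Set where
    constructor witnesses
    field
      first second third   : Spot Hit
      first≢second : position first ≢ position second
      first≢third  : position first ≢ position third
      second≢third : position second ≢ position third

  rows-distinct : ∀ {Hit} → (∀ {r k k′} → Hit r k → Hit r k′ → k ≡ k′) →
                  (s s′ : Spot Hit) → position s ≢ position s′ → ι (row s) ≢ ι (row s′)
  rows-distinct one-layer (spot y k y<n h) (spot y′ k′ y′<n h′) s≢s′ eq
    with refl ← trans (sym (toℕ-ι y y<n)) (trans (cong toℕ eq) (toℕ-ι y′ y′<n))
    = s≢s′ (cong (y ,_) (one-layer h h′))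

  columnHit : ℕ → Fin n → Layer → Set
  columnHit j r k = toℕ (cell k r) ≡ j

  symbolHit : ℕ → Fin n → Layer → Set
  symbolHit t r k = toℕ (L r (cell k r)) ≡ t

  witnesses⇒3≤columnCount : ∀ c → Witnesses (columnHit (toℕ c)) → 3 ≤ columnCount triplex c
  witnesses⇒3≤columnCount c (witnesses s₁ s₂ s₃ s₁≢s₂ s₁≢s₃ s₂≢s₃) =
    3≤count (λ r → triplex r c) (distinct s₁ s₂ s₁≢s₂) (distinct s₁ s₃ s₁≢s₃) (distinct s₂ s₃ s₂≢s₃)
            (in-triplex s₁) (in-triplex s₂) (in-triplex s₃)
    where
    distinct : (s s′ : Spot (columnHit (toℕ c))) → position s ≢ position s′ → ι (row s) ≢ ι (row s′)
    distinct = rows-distinct (λ {r} h h′ → cell-injective r (toℕ-injective (trans h (sym h′))))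
    in-triplex : (s : Spot (columnHit (toℕ c))) → triplex (ι (row s)) c ≡ true
    in-triplex s = subst (λ c′ → triplex (ι (row s)) c′ ≡ true) (toℕ-injective (hit s)) (triplex-cell (layer s) (ι (row s)))

  witnesses⇒3≤symbolCount : ∀ s → Witnesses (symbolHit (toℕ s)) → 3 ≤ symbolCount L triplex s
  witnesses⇒3≤symbolCount s (witnesses s₁ s₂ s₃ s₁≢s₂ s₁≢s₃ s₂≢s₃) =
    3≤symbolCount L triplex (distinct s₁ s₂ s₁≢s₂) (distinct s₁ s₃ s₁≢s₃) (distinct s₂ s₃ s₂≢s₃)
      (triplex-cell (layer s₁) (ι (row s₁))) (triplex-cell (layer s₂) (ι (row s₂))) (triplex-cell (layer s₃) (ι (row s₃)))
      (toℕ-injective (hit s₁)) (toℕ-injective (hit s₂)) (toℕ-injective (hit s₃))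
    where
    distinct : (s′ s″ : Spot (symbolHit (toℕ s))) → position s′ ≢ position s″ → ι (row s′) ≢ ι (row s″)
    distinct = rows-distinct (λ {r} h h′ → cell-injective r (L-row-injective r (toℕ-injective (trans h (sym h′)))))

  ι-0 : ι 0 ≡ zero
  ι-0 = toℕ-injective (toℕ-ι 0 (s≤s z≤n))

  ι-m : ι m ≡ rowm
  ι-m = toℕ-injective (trans (toℕ-ι m m<n) (sym (toℕ-fromℕ< m<n)))

  ≥2m⇒≢0 : ∀ {y} → 2 * m ≤ y → y ≢ 0
  ≥2m⇒≢0 2m≤y refl = <⇒≱ (s≤s z≤n) 2m≤y

  ≥2m⇒≢m : ∀ {y} → 2 * m ≤ y → y ≢ m
  ≥2m⇒≢m 2m≤y refl = <⇒≱ m<2m 2m≤y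

  1%m : 1 % m ≡ 1
  1%m = m<n⇒m%n≡m {n = m} (s≤s (s≤s z≤n))

  column-hit : ∀ k {y o j} q → y < n → j < n → offset k y ≡ o → y + o ≡ j + q * n → columnHit j (ι y) k
  column-hit k {y} {o} {j} q y<n j<n offset≡o eq = begin
    toℕ (cell k (ι y))                            ≡⟨ toℕ-cell k (ι y) ⟩
    (toℕ (ι y) + offset k (toℕ (ι y))) % n        ≡⟨ cong (λ x → (x + offset k x) % n) (toℕ-ι y y<n) ⟩
    (y + offset k y) % n                          ≡⟨ cong (λ x → (y + x) % n) offset≡o ⟩
    (y + o) % n                                   ≡⟨ ≡+kn⇒%≡ j q eq j<n ⟩
    j                                             ∎
    where open ≡-Reasoning

  swapIf-ordinary : ∀ {r} → r ≢ zero → r ≢ rowm → ∀ b → swapIf b r ≡ r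
  swapIf-ordinary r≢0 r≢m true  = transpose-other r≢0 r≢m
  swapIf-ordinary r≢0 r≢m false = refl

  symbol-ordinary : ∀ k {y o t} → y < n → y ≢ 0 → y ≢ m → offset k y ≡ o → (2 * y + o) % n ≡ t → symbolHit t (ι y) k
  symbol-ordinary k {y} {o} {t} y<n y≢0 y≢m offset≡o value = begin
    toℕ (L r (cell k r))                              ≡⟨ toℕ-L r (cell k r) ⟩
    (toℕ (swapIf (B (cell k r)) r) + toℕ (cell k r)) % n
      ≡⟨ cong (λ x → (toℕ x + toℕ (cell k r)) % n) (swapIf-ordinary r≢0 r≢m (B (cell k r))) ⟩
    (toℕ r + toℕ (cell k r)) % n                      ≡⟨ cong (λ x → (toℕ r + x) % n) (toℕ-cell k r) ⟩
    (toℕ r + (toℕ r + offset k (toℕ r)) % n) % n      ≡⟨ %-absorbʳ (toℕ r) (toℕ r + offset k (toℕ r)) ⟩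
    (toℕ r + (toℕ r + offset k (toℕ r))) % n          ≡⟨ cong (λ x → (x + (x + offset k x)) % n) (toℕ-ι y y<n) ⟩
    (y + (y + offset k y)) % n                        ≡⟨ cong (λ x → (y + (y + x)) % n) offset≡o ⟩
    (y + (y + o)) % n                                 ≡⟨ cong (_% n) (double y o) ⟩
    (2 * y + o) % n                                   ≡⟨ value ⟩
    t                                                 ∎
    where
    open ≡-Reasoning
    r : Fin n
    r = ι y
    B : Fin n → Bool
    B c = multipleOfm (toℕ c)
    r≢0 : r ≢ zero
    r≢0 eq = y≢0 (trans (sym (toℕ-ι y y<n)) (cong toℕ eq))
    r≢m : r ≢ rowm
    r≢m eq = y≢m (trans (sym (toℕ-ι y y<n)) (trans (cong toℕ eq) (toℕ-fromℕ< m<n)))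
    double : ∀ y o → y + (y + o) ≡ 2 * y + o
    double = solve-∀

  offset-at-0-residue : ∀ k → offset k 0 % m ≡ 1
  offset-at-0-residue ℓ₁ = 1%m
  offset-at-0-residue ℓ₂ = trans ([m+n]%n≡m%n 1 m) 1%m
  offset-at-0-residue ℓ₃ = trans ([m+kn]%n≡m%n 1 3 m) 1%m

  symbol-row-0 : ∀ k {t} → offset k 0 ≡ t → symbolHit t (ι 0) k
  symbol-row-0 k {t} offset≡t = subst (λ r → symbolHit t r k) (sym ι-0) (begin
    toℕ (L zero (cell k zero))                                 ≡⟨ toℕ-L zero (cell k zero) ⟩
    (toℕ (swapIf (multipleOfm (toℕ (cell k zero))) zero) + toℕ (cell k zero)) % n
      ≡⟨ cong (λ b → (toℕ (swapIf b zero) + toℕ (cell k zero)) % n) plain ⟩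
    toℕ (cell k zero) % n                                      ≡⟨ cong (_% n) column ⟩
    offset k 0 % n                                             ≡⟨ m<n⇒m%n≡m (offset-<n k 0) ⟩
    offset k 0                                                 ≡⟨ offset≡t ⟩
    t                                                          ∎)
    where
    open ≡-Reasoning
    column : toℕ (cell k zero) ≡ offset k 0
    column = trans (toℕ-cell k zero) (m<n⇒m%n≡m (offset-<n k 0))
    plain : multipleOfm (toℕ (cell k zero)) ≡ false
    plain = trans (cong multipleOfm column) (cong (λ x → does (x ≟ 0)) (offset-at-0-residue k))

  toℕ-swapIf-rowm : ∀ b → toℕ (swapIf b rowm) ≡ (if b then 0 else m)
  toℕ-swapIf-rowm true  = cong toℕ transpose-rowm
  toℕ-swapIf-rowm false = toℕ-fromℕ< m<n

  symbol-row-m : ∀ k {x t} → columnHit x rowm k → ((if multipleOfm x then 0 else m) + x) % n ≡ t → symbolHit t (ι m) k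
  symbol-row-m k {x} {t} column value = subst (λ r → symbolHit t r k) (sym ι-m) (begin
    toℕ (L rowm (cell k rowm))                                   ≡⟨ toℕ-L rowm (cell k rowm) ⟩
    (toℕ (swapIf (multipleOfm (toℕ (cell k rowm))) rowm) + toℕ (cell k rowm)) % n
      ≡⟨ cong (λ x → (toℕ (swapIf (multipleOfm x) rowm) + x) % n) column ⟩
    (toℕ (swapIf (multipleOfm x) rowm) + x) % n                  ≡⟨ cong (λ y → (y + x) % n) (toℕ-swapIf-rowm (multipleOfm x)) ⟩
    ((if multipleOfm x then 0 else m) + x) % n                   ≡⟨ value ⟩
    t                                                            ∎)
    where open ≡-Reasoning

  column-row-m : ∀ k {o j} q → j < n → offset k m ≡ o → m + o ≡ j + q * n → columnHit j rowm k
  column-row-m k q j<n offset≡o eq = subst (λ r → columnHit _ r k) ι-m (column-hit k q m<n j<n offset≡o eq)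

  symbol-layer₁ : ∀ {y} → y < n → symbolHit ((2 * y + 1) % n) (ι y) ℓ₁
  symbol-layer₁ {y} y<n with y ≟ 0 | y ≟ m
  ... | yes refl | _        = symbol-row-0 ℓ₁ refl
  ... | no _     | yes refl = symbol-row-m ℓ₁ (column-row-m ℓ₁ 0 m+1<n refl (sym (+-identityʳ (m + 1))))
                                          (trans (cong (λ b → ((if b then 0 else m) + (m + 1)) % n) plain) (cong (_% n) (regroup m)))
    where
    m+1<n : m + 1 < n
    m+1<n = subst (_< n) (+-comm 1 m) suc-m<n
    plain : multipleOfm (m + 1) ≡ false
    plain = cong (λ x → does (x ≟ 0)) (trans (cong (_% m) (+-comm m 1)) (trans ([m+n]%n≡m%n 1 m) 1%m))
    regroup : ∀ m → m + (m + 1) ≡ 2 * m + 1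
    regroup = solve-∀
  ... | no y≢0   | no y≢m   = symbol-ordinary ℓ₁ y<n y≢0 y≢m refl refl

  -- `earlyPair` yields two Early witnesses and `lateSpot` one Late witness; as the two kinds
  -- never share a position, the three witnesses are distinct.
  data Early : ℕ → Layer → Set where
    early₁ : ∀ {y} → Early y ℓ₁
    early₂ : ∀ {y} → y ≢ 0 → y ≢ m → Early y ℓ₂
    early₃ : ∀ {y} → y ≡ m ⊎ y ≡ last → Early y ℓ₃

  data Late : ℕ → Layer → Set where
    late₂ : ∀ {y} → y ≡ 0 ⊎ y ≡ m → Late y ℓ₂
    late₃ : ∀ {y} → y ≢ m → y ≢ last → Late y ℓ₃

  early≢late : ∀ {y k y′ k′} → Early y k → Late y′ k′ → (y , k) ≢ (y′ , k′)
  early≢late early₁                (late₂ _)           ()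
  early≢late early₁                (late₃ _ _)         ()
  early≢late (early₂ y≢0 _)        (late₂ (inj₁ refl)) refl = y≢0 refl
  early≢late (early₂ _ y≢m)        (late₂ (inj₂ refl)) refl = y≢m refl
  early≢late (early₂ _ _)          (late₃ _ _)         ()
  early≢late (early₃ _)            (late₂ _)           ()
  early≢late (early₃ (inj₁ refl))  (late₃ y≢m _)       refl = y≢m refl
  early≢late (early₃ (inj₂ refl))  (late₃ _ y≢last)    refl = y≢last refl

  Kinded : (ℕ → Layer → Set) → ℕ → Set
  Kinded Kind t = Σ (Spot (symbolHit t)) (λ s → Kind (row s) (layer s))

  record EarlyPair (t : ℕ) : Set where
    constructor pair
    field
      one two : Kinded Early t
      one≢two : position (proj₁ one) ≢ position (proj₁ two)

  oddPair : ∀ a → suc (2 * a) < n → EarlyPair (suc (2 * a))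
  oddPair a t<n = pair
    (spot a ℓ₁ a<n (trans (symbol-layer₁ a<n) (trans (cong (_% n) (+-comm (2 * a) 1)) (m<n⇒m%n≡m t<n))) , early₁)
    (spot (a + 2 * m) ℓ₁ (+2m<n a<2m) (trans (symbol-layer₁ (+2m<n a<2m)) (≡+kn⇒%≡ (suc (2 * a)) 1 (eq a m) t<n)) , early₁)
    (λ eq → <⇒≢ (m<m+n a (s≤s z≤n)) (cong proj₁ eq))
    where
    a<2m : a < 2 * m
    a<2m = half< (<-trans (n<1+n (2 * a)) t<n)
    a<n : a < n
    a<n = <-trans a<2m 2m<n
    eq : ∀ a m → 2 * (a + 2 * m) + 1 ≡ suc (2 * a) + 1 * (m * 4)
    eq = solve-∀

  zeroPair : EarlyPair 0
  zeroPair = pair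
    (spot (2 * m) ℓ₂ 2m<n (symbol-ordinary ℓ₂ 2m<n 2m≢0 2m≢m (offset₂-≢0 2m≢0) (≡+kn⇒%≡ 0 1 (eq₁ m) (s≤s z≤n)))
      , early₂ 2m≢0 2m≢m)
    (spot m ℓ₃ m<n (symbol-row-m ℓ₃ (column-row-m ℓ₃ 1 (s≤s z≤n) offset₃-m (eq₂ m)) refl) , early₃ (inj₁ refl))
    (λ ())
    where
    2m≢0 : 2 * m ≢ 0
    2m≢0 = ≥2m⇒≢0 ≤-refl
    2m≢m : 2 * m ≢ m
    2m≢m = ≥2m⇒≢m ≤-refl
    eq₁ : ∀ m → 2 * (2 * m) + 0 ≡ 0 + 1 * (m * 4)
    eq₁ = solve-∀
    eq₂ : ∀ m → m + 3 * m ≡ 0 + 1 * (m * 4)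
    eq₂ = solve-∀

  middlePair : EarlyPair (2 * m)
  middlePair = pair
    (spot (3 * m) ℓ₂ 3m<n (symbol-ordinary ℓ₂ 3m<n (λ ()) 3m≢m (offset₂-≢0 {3 * m} (λ ())) (≡+kn⇒%≡ (2 * m) 1 (eq₁ m) 2m<n))
      , early₂ (λ ()) 3m≢m)
    (spot last ℓ₃ last<n (symbol-ordinary ℓ₃ last<n (λ ()) (m≢last ∘ sym) offset₃-last (≡+kn⇒%≡ (2 * m) 2 (eq₂ p) 2m<n))
      , early₃ (inj₂ refl))
    (λ ())
    where
    3m≢m : 3 * m ≢ m
    3m≢m = <⇒≢ m<3m ∘ sym
    eq₁ : ∀ m → 2 * (3 * m) + 0 ≡ 2 * m + 1 * (m * 4)
    eq₁ = solve-∀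
    eq₂ : ∀ p → 2 * (3 * (2 + p) + suc p) + (2 + 2 * (2 + p)) ≡ 2 * (2 + p) + 2 * ((2 + p) * 4)
    eq₂ = solve-∀

  evenPair : ∀ a → 2 * a < n → a ≢ 0 → a ≢ m → EarlyPair (2 * a)
  evenPair a t<n a≢0 a≢m = pair
    (spot a ℓ₂ a<n (symbol-ordinary ℓ₂ a<n a≢0 a≢m (offset₂-≢0 a≢0) (≡+kn⇒%≡ (2 * a) 0 (eq₁ a) t<n))
      , early₂ a≢0 a≢m)
    (spot y ℓ₂ y<n (symbol-ordinary ℓ₂ y<n y≢0 y≢m (offset₂-≢0 y≢0) (≡+kn⇒%≡ (2 * a) 1 (eq₂ a m) t<n))
      , early₂ y≢0 y≢m)
    (λ eq → <⇒≢ (m<m+n a (s≤s z≤n)) (cong proj₁ eq))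
    where
    a<n : a < n
    a<n = <-trans (half< t<n) 2m<n
    y : ℕ
    y = a + 2 * m
    y<n : y < n
    y<n = +2m<n (half< t<n)
    y≢0 : y ≢ 0
    y≢0 = ≥2m⇒≢0 (m≤n+m (2 * m) a)
    y≢m : y ≢ m
    y≢m = ≥2m⇒≢m (m≤n+m (2 * m) a)
    eq₁ : ∀ a → 2 * a + 0 ≡ 2 * a + 0 * 0
    eq₁ = solve-∀
    eq₂ : ∀ a m → 2 * (a + 2 * m) + 0 ≡ 2 * a + 1 * (m * 4)
    eq₂ = solve-∀

  lateOdd : ∀ b → suc (2 * b) < n → Kinded Late ((suc (2 * b) + m) % n)
  lateOdd b u<n with b ≟ 0 | b ≟ m
  ... | yes refl | _        = spot 0 ℓ₂ (s≤s z≤n) (symbol-row-0 ℓ₂ (sym (m<n⇒m%n≡m suc-m<n))) , late₂ (inj₁ refl)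
  ... | no _     | yes refl =
    spot 0 ℓ₃ (s≤s z≤n) (symbol-row-0 ℓ₃ (sym (≡+kn⇒%≡ (suc (3 * m)) 0 (eq m) (offset-<n ℓ₃ 0)))) , late₃ (λ ()) (λ ())
    where
    eq : ∀ m → suc (2 * m) + m ≡ suc (3 * m) + 0 * (m * 4)
    eq = solve-∀
  ... | no b≢0   | no b≢m   =
    spot b ℓ₃ b<n (symbol-ordinary ℓ₃ b<n b≢0 b≢m (offset₃-low b≢0 b≢m b<2m) (cong (_% n) (eq b m)))
    , late₃ b≢m (<⇒≢ (<-≤-trans b<2m 2m≤last))
    where
    b<2m : b < 2 * m
    b<2m = half< (<-trans (n<1+n (2 * b)) u<n)
    b<n : b < n
    b<n = <-trans b<2m 2m<n
    eq : ∀ b m → 2 * b + suc m ≡ suc (2 * b) + m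
    eq = solve-∀

  lateEven : ∀ b → 2 * b < n → Kinded Late ((2 * b + m) % n)
  lateEven zero     _   =
    spot m ℓ₂ m<n (symbol-row-m ℓ₂ (column-row-m ℓ₂ 0 m<n (offset₂-≢0 {m} (λ ())) (eq m))
                                   (cong (λ b → ((if b then 0 else m) + m) % n) m-multiple))
    , late₂ (inj₂ refl)
    where
    m-multiple : multipleOfm m ≡ true
    m-multiple = cong (λ x → does (x ≟ 0)) (n%n≡0 m)
    eq : ∀ m → m + 0 ≡ m + 0 * (m * 4)
    eq = solve-∀
  lateEven (suc b′) u<n =
    spot y ℓ₃ y<n (symbol-ordinary ℓ₃ y<n (≥2m⇒≢0 2m≤y) (≥2m⇒≢m 2m≤y) (offset₃-high 2m≤y y<last)
                                   (trans (cong (_% n) (eq₁ b′ m)) ([m+kn]%n≡m%n (2 * suc b′ + m) 1 n)))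
    , late₃ (≥2m⇒≢m 2m≤y) (<⇒≢ y<last)
    where
    y : ℕ
    y = b′ + 2 * m
    2m≤y : 2 * m ≤ y
    2m≤y = m≤n+m (2 * m) b′
    y<last : y < last
    y<last = ≤-pred (subst (suc (suc y) ≤_) (eq₂ p) (+-monoˡ-≤ (2 * m) (half< {suc b′} u<n)))
      where
      eq₂ : ∀ p → 2 * (2 + p) + 2 * (2 + p) ≡ suc (3 * (2 + p) + suc p)
      eq₂ = solve-∀
    y<n : y < n
    y<n = <-trans y<last last<n
    eq₁ : ∀ b′ m → 2 * (b′ + 2 * m) + (2 + m) ≡ 2 * suc b′ + m + 1 * (m * 4)
    eq₁ = solve-∀

  lateAt : ∀ u → u < n → Kinded Late ((u + m) % n)
  lateAt u u<n with parity u
  ... | b , inj₁ refl = lateEven b u<n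
  ... | b , inj₂ refl = lateOdd b u<n

  -- The late witness for t is the one for u = t - m (mod n).
  lateSpot : ∀ t → t < n → Kinded Late t
  lateSpot t t<n = subst (Kinded Late) back (lateAt ((t + 3 * m) % n) (m%n<n (t + 3 * m) n))
    where
    back : ((t + 3 * m) % n + m) % n ≡ t
    back = trans (%-absorbˡ (t + 3 * m) m) (≡+kn⇒%≡ t 1 (eq t m) t<n)
      where
      eq : ∀ t m → t + 3 * m + m ≡ t + 1 * (m * 4)
      eq = solve-∀

  earlyPair : ∀ t → t < n → EarlyPair t
  earlyPair t t<n with parity t
  ... | a , inj₂ refl = oddPair a t<n
  ... | a , inj₁ refl with a ≟ 0 | a ≟ m
  ...   | yes refl | _        = zeroPair
  ...   | no _     | yes refl = middlePair
  ...   | no a≢0   | no a≢m   = evenPair a t<n a≢0 a≢m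

  symbolWitnesses : ∀ s → Witnesses (symbolHit (toℕ s))
  symbolWitnesses s with earlyPair (toℕ s) (toℕ<n s) | lateSpot (toℕ s) (toℕ<n s)
  ... | pair (s₁ , early-s₁) (s₂ , early-s₂) s₁≢s₂ | s₃ , late-s₃ =
    witnesses s₁ s₂ s₃ s₁≢s₂ (early≢late early-s₁ late-s₃) (early≢late early-s₂ late-s₃)

  data ColumnLate : ℕ → Layer → Set where
    via₃ : ∀ {y} → ColumnLate y ℓ₃
    via₂ : ColumnLate 0 ℓ₂

  thirdColumn : ∀ j → j < n → Σ (Spot (columnHit j)) (λ s → ColumnLate (row s) (layer s))
  thirdColumn j j<n with <-cmp j (suc m)
  ... | tri< j<1+m _ _ = spot y ℓ₃ y<n (column-hit ℓ₃ 1 y<n j<n (offset₃-high 2m≤y y<last) (eq j p)) , via₃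
    where
    y : ℕ
    y = j + (2 * m + p)
    2m≤y : 2 * m ≤ y
    2m≤y = ≤-trans (m≤m+n (2 * m) p) (m≤n+m _ j)
    y<last : y < last
    y<last = subst (y <_) (eq′ p) (+-monoˡ-< (2 * m + p) j<1+m)
      where
      eq′ : ∀ p → suc (2 + p) + (2 * (2 + p) + p) ≡ 3 * (2 + p) + suc p
      eq′ = solve-∀
    y<n : y < n
    y<n = <-trans y<last last<n
    eq : ∀ j p → j + (2 * (2 + p) + p) + (2 + (2 + p)) ≡ j + 1 * ((2 + p) * 4)
    eq = solve-∀
  ... | tri≈ _ refl _ = spot 0 ℓ₂ (s≤s z≤n) (column-hit ℓ₂ 0 (s≤s z≤n) j<n refl (sym (+-identityʳ (suc m)))) , via₂
  ... | tri> _ _ 1+m<j with m≤n⇒∃[o]m+o≡n 1+m<j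
  ...   | o , refl with <-cmp (suc o) (2 * m)
  ...     | tri< y<2m _ _ with suc o ≟ m
  ...       | yes refl = spot last ℓ₃ last<n (column-hit ℓ₃ 1 last<n j<n offset₃-last (eq p)) , via₃
    where
    eq : ∀ p → 3 * (2 + p) + suc p + (2 + 2 * (2 + p)) ≡ suc (suc (2 + p)) + suc p + 1 * ((2 + p) * 4)
    eq = solve-∀
  ...       | no y≢m   = spot (suc o) ℓ₃ y<n (column-hit ℓ₃ 0 y<n j<n (offset₃-low (λ ()) y≢m y<2m) (eq o m)) , via₃
    where
    y<n : suc o < n
    y<n = <-trans y<2m 2m<n
    eq : ∀ o m → suc o + suc m ≡ suc (suc m) + o + 0 * (m * 4)
    eq = solve-∀
  thirdColumn _ j<n | tri> _ _ _ | o , refl | tri≈ _ y≡2m _ =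
    spot 0 ℓ₃ (s≤s z≤n) (column-hit ℓ₃ 0 (s≤s z≤n) j<n refl hits) , via₃
    where
    hits : suc (3 * m) ≡ suc (suc m) + o + 0 * n
    hits = begin
      suc (3 * m)              ≡⟨ eq₁ m ⟩
      suc m + 2 * m            ≡⟨ cong (suc m +_) y≡2m ⟨
      suc m + suc o            ≡⟨ eq₂ m o ⟩
      suc (suc m) + o + 0 * n  ∎
      where
      open ≡-Reasoning
      eq₁ : ∀ m → suc (3 * m) ≡ suc m + 2 * m
      eq₁ = solve-∀
      eq₂ : ∀ m o → suc m + suc o ≡ suc (suc m) + o + 0 * (m * 4)
      eq₂ = solve-∀
  thirdColumn _ j<n | tri> _ _ _ | o , refl | tri> _ _ 2m<y =
    spot o ℓ₃ o<n (column-hit ℓ₃ 0 o<n j<n (offset₃-high (s≤s⁻¹ 2m<y) o<last) (eq o m)) , via₃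
    where
    o<last : o < last
    o<last = <-trans (m<n+m o (s≤s z≤n)) (s<s⁻¹ (subst (suc (suc m) + o <_) (sym suc-last≡n) j<n))
    o<n : o < n
    o<n = <-trans o<last last<n
    eq : ∀ o m → o + (2 + m) ≡ suc (suc m) + o + 0 * (m * 4)
    eq = solve-∀

  columnWitnesses : ∀ j → j < n → Witnesses (columnHit j)
  columnWitnesses zero _ = witnesses
    (spot last ℓ₁ last<n (column-hit ℓ₁ 1 last<n (s≤s z≤n) refl (eq₁ p)))
    (spot m ℓ₃ m<n (column-hit ℓ₃ 1 m<n (s≤s z≤n) offset₃-m (eq₂ m)))
    (spot y ℓ₃ y<n (column-hit ℓ₃ 1 y<n (s≤s z≤n) (offset₃-high (m≤m+n (2 * m) p) y<last) (eq₃ p)))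
    (λ ()) (λ ()) (λ eq → <⇒≢ (<-≤-trans m<2m (m≤m+n (2 * m) p)) (cong proj₁ eq))
    where
    y : ℕ
    y = 2 * m + p
    y<last : y < last
    y<last = <-by m (eq p)
      where
      eq : ∀ p → suc (2 * (2 + p) + p) + (2 + p) ≡ 3 * (2 + p) + suc p
      eq = solve-∀
    y<n : y < n
    y<n = <-trans y<last last<n
    eq₁ : ∀ p → 3 * (2 + p) + suc p + 1 ≡ 0 + 1 * ((2 + p) * 4)
    eq₁ = solve-∀
    eq₂ : ∀ m → m + 3 * m ≡ 0 + 1 * (m * 4)
    eq₂ = solve-∀
    eq₃ : ∀ p → 2 * (2 + p) + p + (2 + (2 + p)) ≡ 0 + 1 * ((2 + p) * 4)
    eq₃ = solve-∀
  columnWitnesses (suc i) j<n with thirdColumn (suc i) j<n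
  ... | s₃ , late = witnesses
    (spot i ℓ₁ i<n (column-hit ℓ₁ 0 i<n j<n refl (eq i)))
    (spot (suc i) ℓ₂ j<n (column-hit ℓ₂ 0 j<n j<n (offset₂-≢0 {suc i} (λ ())) (eq′ i)))
    s₃
    (λ ()) (ℓ₁≢late late) (ℓ₂≢late late)
    where
    i<n : i < n
    i<n = <-trans (n<1+n i) j<n
    eq : ∀ i → i + 1 ≡ suc i + 0 * n
    eq = solve-∀
    eq′ : ∀ i → suc i + 0 ≡ suc i + 0 * n
    eq′ = solve-∀
    ℓ₁≢late : ∀ {y k} → ColumnLate y k → (i , ℓ₁) ≢ (y , k)
    ℓ₁≢late via₃ ()
    ℓ₁≢late via₂ ()
    ℓ₂≢late : ∀ {y k} → ColumnLate y k → (suc i , ℓ₂) ≢ (y , k)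
    ℓ₂≢late via₃ ()
    ℓ₂≢late via₂ ()

  L-triplex : HasTriplex L
  L-triplex = triplex , plex-of-lowerBounds triplex triplex-row L
    (λ c → witnesses⇒3≤columnCount c (columnWitnesses (toℕ c) (toℕ<n c)))
    (λ s → witnesses⇒3≤symbolCount s (symbolWitnesses s))

open TurnedCyclic using (L; L-latin; L-triplex; L-no-transversal)

corollary4p4 : (n : ℕ) → 8 ≤ n → 4 ∣ n →
    ∃[ L ] (IsLatin {n} L × HasTriplex L × ¬ HasTransversal L)
corollary4p4 _ 8≤0 (divides 0 refl) = contradiction 8≤0 (<⇒≱ (s≤s z≤n))
corollary4p4 _ 8≤4 (divides 1 refl) = contradiction 8≤4 (<⇒≱ (s≤s (s≤s (s≤s (s≤s (s≤s z≤n))))))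
corollary4p4 _ _ (divides (suc (suc p)) refl) = L p , L-latin p , L-triplex p , L-no-transversal p
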